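{- Let $n\ge2$ be an integer and let $P_n$ be the path with $n$ edges (and $n+1$ vertices). Then (1) $H(\mu(P_n),x)=(4n+1)\,x+\tfrac12\left(n^2+11n-2\right)x^2+(n^2-2n)\,x^3+\tfrac12\left(n^2-5n+6\right)x^4$; (2) the Wiener index of $\mu(P_n)$ is $W(\mu(P_n))=6n^2-n+11$.
   Context: For a graph $G$ and integer $k\ge1$, $d(G,k)$ is the number of unordered pairs of distinct vertices at distance exactly $k$, and the Hosoya polynomial of $G$ (of diameter $D$) is $H(G,x)=\sum_{k=1}^{D} d(G,k)x^k$. The Wiener index is $W(G)=\sum_{\{i,j\}}d(i,j)$, the sum over unordered pairs of distinct vertices. The Mycielskian graph $\mu(G)$ of a graph $G$ with vertex set $\{v_1,\dots,v_n\}$ has vertex set $\{v_1,\dots,v_n,u_1,\dots,u_n,w\}$ and edge set $E(G)\cup\{wu_i : 1\le i\le n\}\cup\{u_iv_j,\ u_jv_i : v_iv_j\in E(G)\}$. -}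

module Defs where

open import Data.Nat using (ℕ; zero; suc; _+_; _*_; _∸_; _<ᵇ_; _≡ᵇ_)
open import Data.Bool using (Bool; true; false; _∧_; _∨_; not; if_then_else_)
open import Data.Fin using (Fin; toℕ; splitAt)
open import Data.List using (List; map; allFin)
open import Data.Nat.ListAction using (sum)
open import Data.Bool.ListAction using (any)
open import Data.Sum using (_⊎_; inj₁; inj₂)

record Graph : Set where
  field
    order : ℕ
    adj   : Fin order → Fin order → Bool
open Graph public

reach : (G : Graph) → ℕ → Fin (order G) → Fin (order G) → Bool
reach G zero    u v = toℕ u ≡ᵇ toℕ v
reach G (suc k) u v =
  reach G k u v ∨ any (λ w → reach G k u w ∧ adj G w v) (allFin (order G))

-- graph distance: least k with d(u,v) ≤ k (searched in 0..order;
-- for vertices in different components the value `order` is returned,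
-- which never matters for connected graphs)
dist : (G : Graph) → Fin (order G) → Fin (order G) → ℕ
dist G u v = go 0 (order G)
  where
  go : ℕ → ℕ → ℕ
  go k zero    = k
  go k (suc f) = if reach G k u v then k else go (suc k) f

distIs : (G : Graph) → ℕ → Fin (order G) → Fin (order G) → Bool
distIs G zero    u v = reach G zero u v
distIs G (suc k) u v = reach G (suc k) u v ∧ not (reach G k u v)

pairSum : (G : Graph) → (Fin (order G) → Fin (order G) → ℕ) → ℕ
pairSum G f =
  sum (map (λ i → sum (map (λ j → if toℕ i <ᵇ toℕ j then f i j else 0)
                           (allFin (order G))))
           (allFin (order G)))

dcount : Graph → ℕ → ℕ
dcount G k = pairSum G (λ i j → if distIs G k i j then 1 else 0)

wiener : Graph → ℕ
wiener G = pairSum G (dist G)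

path : ℕ → Graph
path n = record
  { order = suc n
  ; adj   = λ i j → (suc (toℕ i) ≡ᵇ toℕ j) ∨ (suc (toℕ j) ≡ᵇ toℕ i)
  }

data MV (n : ℕ) : Set where
  vv : Fin n → MV n
  uu : Fin n → MV n
  ww : MV n

classify : (n : ℕ) → Fin (n + (n + 1)) → MV n
classify n x with splitAt n x
... | inj₁ i = vv i
... | inj₂ y with splitAt n y
...   | inj₁ i = uu i
...   | inj₂ _ = ww

myAdj : (n : ℕ) → (Fin n → Fin n → Bool) → MV n → MV n → Bool
myAdj n a (vv i) (vv j) = a i j
myAdj n a (vv i) (uu j) = a j i   -- u_j v_i  with v_j v_i ∈ E
myAdj n a (uu i) (vv j) = a i j   -- u_i v_j  with v_i v_j ∈ E
myAdj n a (uu i) ww     = true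
myAdj n a ww     (uu j) = true
myAdj n a _      _      = false

mycielskian : Graph → Graph
mycielskian G = record
  { order = order G + (order G + 1)
  ; adj   = λ x y → myAdj (order G) (adj G) (classify (order G) x) (classify (order G) y)
  }

-- 2 × (coefficient of x^k in the claimed Hosoya polynomial of μ(P_n))
hosoyaRHS2 : ℕ → ℕ → ℕ
hosoyaRHS2 n 1 = 2 * (4 * n + 1)
hosoyaRHS2 n 2 = n * n + 11 * n ∸ 2
hosoyaRHS2 n 3 = 2 * (n * n ∸ 2 * n)
hosoyaRHS2 n 4 = n * n + 6 ∸ 5 * n
hosoyaRHS2 n _ = 0

-- Distances in μ(P n) depend only on the layers of the two vertices (v, u or w) and, inside
-- the v- and u-layers, on the gap |i − j| of the path indices, saturating at gap 4:
-- d(v i, v j) = min(|i − j|, 4), d(v i, u j) = 2, 1, 2, 3 for the gaps 0, 1, 2, ≥ 3,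
-- d(u i, u j) = 2 for i ≠ j, d(v i, w) = 2 and d(u i, w) = 1.  A candidate function is the
-- graph distance as soon as it vanishes exactly on the diagonal, grows by at most one along
-- an edge, and every positive value is reached from a neighbour one step closer; all three
-- reduce to finitely many checks on the gap profiles.  Counting ordered pairs of path
-- indices at each gap (there are 2 C(n − 2, 2) at gap ≥ 4) then gives the number of pairs
-- at every distance, i.e. the Hosoya polynomial, and weighting by the distance gives W.
module Submission where

open import Defs
open import Data.Bool using (Bool; true; false; _∧_; not; if_then_else_; T)
open import Data.Bool.Properties using (T-∨; T-∧)
open import Data.Empty using (⊥-elim)
open import Data.Fin using (Fin; toℕ; fromℕ<; _↑ˡ_; _↑ʳ_; splitAt) renaming (zero to 0F; suc to sucF)
open import Data.Fin.Patterns using (1F; 2F; 3F; 4F)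
open import Data.Fin.Properties
  using (toℕ-injective; toℕ<n; toℕ-fromℕ<; splitAt-↑ˡ; splitAt-↑ʳ; join-splitAt; all?)
open import Data.List using (allFin; map; tabulate)
open import Data.List.Membership.Propositional using (lose)
open import Data.List.Membership.Propositional.Properties using (∈-allFin)
open import Data.List.Properties using (map-tabulate)
open import Data.List.Relation.Unary.Any using (satisfied)
open import Data.List.Relation.Unary.Any.Properties using (any⁺; any⁻)
open import Data.Nat
  using (ℕ; zero; suc; _+_; _*_; _∸_; _≤_; _<_; _≤?_; z≤n; s≤s; _≤ᵇ_; _<ᵇ_; _≡ᵇ_; ∣_-_∣)
open import Data.Nat.Combinatorics using (_C_; nC1≡n; nCk+nC[k+1]≡[n+1]C[k+1])
open import Data.Nat.ListAction using (sum)
open import Data.Nat.Properties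
open import Algebra.Properties.CommutativeMonoid.Sum +-0-commutativeMonoid
  using (sum-syntax; ∑-distrib-+; ∑-comm; sum-cong-≗)
open import Data.Nat.Tactic.RingSolver using (solve-∀)
open import Data.Product using (_×_; _,_; ∃-syntax; proj₁; proj₂)
open import Data.Sum using (_⊎_; inj₁; inj₂; swap) renaming (map to map⊎)
open import Data.Vec.Functional using (Vector; []; _∷_)
open import Function.Base using (id; _∘_)
open import Function.Bundles using (module Equivalence)
open import Relation.Binary.PropositionalEquality
open import Relation.Nullary.Decidable using (Dec; True; toWitness; ¬?; _×-dec_; _⊎-dec_)
open import Relation.Nullary.Negation using (contradiction)
open import Relation.Nullary.Reflects using (ofʸ; ofⁿ)

open Equivalence using (to; from)

T-ext : ∀ {x y} → (T x → T y) → (T y → T x) → x ≡ y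
T-ext {false} {false} _ _ = refl
T-ext {false} {true}  _ f = ⊥-elim (f _)
T-ext {true}  {false} t _ = ⊥-elim (t _)
T-ext {true}  {true}  _ _ = refl

<ᵇ-suc∧not<ᵇ : ∀ m k → ((m <ᵇ suc k) ∧ not (m <ᵇ k)) ≡ (m ≡ᵇ k)
<ᵇ-suc∧not<ᵇ zero    zero    = refl
<ᵇ-suc∧not<ᵇ zero    (suc k) = refl
<ᵇ-suc∧not<ᵇ (suc m) zero    = refl
<ᵇ-suc∧not<ᵇ (suc m) (suc k) = <ᵇ-suc∧not<ᵇ m k

≤ᵇ-suc∧not≤ᵇ : ∀ m k → ((m ≤ᵇ suc k) ∧ not (m ≤ᵇ k)) ≡ (m ≡ᵇ suc k)
≤ᵇ-suc∧not≤ᵇ zero    k = refl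
≤ᵇ-suc∧not≤ᵇ (suc m) k = <ᵇ-suc∧not<ᵇ m k

m≡n+o⇒m∸n≡o : ∀ {m n o} → m ≡ n + o → m ∸ n ≡ o
m≡n+o⇒m∸n≡o {n = n} {o} eq = trans (cong (_∸ n) eq) (m+n∸m≡n n o)

-- Graph distance

record IsGraphDistance {V : Set} (E : V → V → Bool) (δ : V → V → ℕ) : Set where
  field
    δ≡0⇒≡         : ∀ {u v} → δ u v ≡ 0 → u ≡ v
    δ-refl        : ∀ u → δ u u ≡ 0
    δ-edge        : ∀ u {w v} → T (E w v) → δ u v ≤ suc (δ u w)
    δ-predecessor : ∀ u {v d} → δ u v ≡ suc d → ∃[ w ] T (E w v) × δ u w ≡ d

IsGraphDistance-pullback : ∀ {A B : Set} {E : B → B → Bool} {δ : B → B → ℕ} (f : A → B) (g : B → A) →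
  (∀ b → f (g b) ≡ b) → (∀ a → g (f a) ≡ a) → IsGraphDistance E δ →
  IsGraphDistance (λ x y → E (f x) (f y)) (λ x y → δ (f x) (f y))
IsGraphDistance-pullback {E = E} {δ} f g fg gf isDist = record
  { δ≡0⇒≡         = λ {u} {v} h → trans (sym (gf u)) (trans (cong g (δ≡0⇒≡ h)) (gf v))
  ; δ-refl        = δ-refl ∘ f
  ; δ-edge        = λ u → δ-edge (f u)
  ; δ-predecessor = predecessor
  }
  where
  open IsGraphDistance isDist
  predecessor : ∀ u {v d} → δ (f u) (f v) ≡ suc d → ∃[ w ] T (E (f w) (f v)) × δ (f u) (f w) ≡ d
  predecessor u {v} {d} h with δ-predecessor (f u) h
  ... | w , wv = g w , subst (λ b → T (E b (f v)) × δ (f u) b ≡ d) (sym (fg w)) wv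

search₅≡ : ∀ (r : ℕ → Bool) d X → d ≤ 4 → (∀ k → r k ≡ (d ≤ᵇ k)) →
  (if r 0 then 0 else if r 1 then 1 else if r 2 then 2 else if r 3 then 3 else if r 4 then 4 else X) ≡ d
search₅≡ r d X d≤4 r≡ rewrite r≡ 0 | r≡ 1 | r≡ 2 | r≡ 3 | r≡ 4 = search d d≤4
  where
  search : ∀ d → d ≤ 4 →
    (if d ≤ᵇ 0 then 0 else if d ≤ᵇ 1 then 1 else if d ≤ᵇ 2 then 2 else
     if d ≤ᵇ 3 then 3 else if d ≤ᵇ 4 then 4 else X) ≡ d
  search 0 _ = refl
  search 1 _ = refl
  search 2 _ = refl
  search 3 _ = refl
  search 4 _ = refl
  search (suc (suc (suc (suc (suc _))))) (s≤s (s≤s (s≤s (s≤s ()))))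

-- `dist` searches with a function local to Defs; for a graph whose order is a variable N ≥ 5
-- the first five search steps unfold definitionally.
reach≡≤ᵇ⇒dist≡ : ∀ {N} (a : Fin N → Fin N → Bool) → 5 ≤ N → ∀ {u v} d → d ≤ 4 →
  (∀ k → reach (record { order = N ; adj = a }) k u v ≡ (d ≤ᵇ k)) →
  dist (record { order = N ; adj = a }) u v ≡ d
reach≡≤ᵇ⇒dist≡ a (s≤s (s≤s (s≤s (s≤s (s≤s _))))) {u} {v} d = search₅≡ (λ k → reach _ k u v) d _

module _ {G : Graph} {δ : Fin (order G) → Fin (order G) → ℕ} (isDist : IsGraphDistance (adj G) δ) where
  open IsGraphDistance isDist

  reach⇒δ≤ : ∀ k {u v} → T (reach G k u v) → δ u v ≤ k
  reach⇒δ≤ zero {u} {v} r with toℕ-injective {i = u} {j = v} (≡ᵇ⇒≡ _ _ r)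
  ... | refl = ≤-reflexive (δ-refl u)
  reach⇒δ≤ (suc k) {u} {v} r with to T-∨ r
  ... | inj₁ r′ = m≤n⇒m≤1+n (reach⇒δ≤ k r′)
  ... | inj₂ r′ with satisfied (any⁻ (λ w → reach G k u w ∧ adj G w v) (allFin (order G)) r′)
  ...   | w , r∧a with to T-∧ r∧a
  ...     | rw , a = ≤-trans (δ-edge u a) (s≤s (reach⇒δ≤ k rw))

  δ≤⇒reach : ∀ k {u v} → δ u v ≤ k → T (reach G k u v)
  δ≤⇒reach zero {u} δ≤0 with δ≡0⇒≡ (n≤0⇒n≡0 δ≤0)
  ... | refl = ≡⇒≡ᵇ (toℕ u) (toℕ u) refl
  δ≤⇒reach (suc k) {u} {v} δ≤ with m≤n⇒m<n∨m≡n δ≤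
  ... | inj₁ (s≤s δ≤k) = from T-∨ (inj₁ (δ≤⇒reach k δ≤k))
  ... | inj₂ δ≡ with δ-predecessor u δ≡
  ...   | w , a , δw = from T-∨ (inj₂ (any⁺ (λ w → reach G k u w ∧ adj G w v)
                          (lose (∈-allFin w) (from T-∧ (δ≤⇒reach k (≤-reflexive δw) , a)))))

  reach≡δ≤ᵇ : ∀ k u v → reach G k u v ≡ (δ u v ≤ᵇ k)
  reach≡δ≤ᵇ k u v = T-ext (≤⇒≤ᵇ ∘ reach⇒δ≤ k) (δ≤⇒reach k ∘ ≤ᵇ⇒≤ _ _)

  distIs≡δ≡ᵇ : ∀ k u v → distIs G (suc k) u v ≡ (δ u v ≡ᵇ suc k)
  distIs≡δ≡ᵇ k u v = begin
    reach G (suc k) u v ∧ not (reach G k u v)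
      ≡⟨ cong₂ (λ a b → a ∧ not b) (reach≡δ≤ᵇ (suc k) u v) (reach≡δ≤ᵇ k u v) ⟩
    (δ u v ≤ᵇ suc k) ∧ not (δ u v ≤ᵇ k)
      ≡⟨ ≤ᵇ-suc∧not≤ᵇ (δ u v) k ⟩
    δ u v ≡ᵇ suc k
      ∎
    where open ≡-Reasoning

  dist≡δ : 5 ≤ order G → ∀ u v → δ u v ≤ 4 → dist G u v ≡ δ u v
  dist≡δ 5≤N u v δ≤4 = reach≡≤ᵇ⇒dist≡ (adj G) 5≤N (δ u v) δ≤4 (λ k → reach≡δ≤ᵇ k u v)

-- Finite sums

sum-tabulate : ∀ {n} (f : Fin n → ℕ) → sum (tabulate f) ≡ ∑[ i < n ] f i
sum-tabulate {zero}  f = refl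
sum-tabulate {suc n} f = cong (f 0F +_) (sum-tabulate (f ∘ sucF))

sum-map-allFin : ∀ {n} (f : Fin n → ℕ) → sum (map f (allFin n)) ≡ ∑[ i < n ] f i
sum-map-allFin f = trans (cong sum (map-tabulate id f)) (sum-tabulate f)

∑-const : ∀ n c → ∑[ i < n ] c ≡ n * c
∑-const zero    c = refl
∑-const (suc n) c = cong (c +_) (∑-const n c)

∑-+-const : ∀ m (f h : Fin m → ℕ) c → ∑[ i < m ] (f i + h i + c) ≡ ∑[ i < m ] f i + ∑[ i < m ] h i + m * c
∑-+-const m f h c = trans (∑-distrib-+ (λ i → f i + h i) (λ _ → c)) (cong₂ _+_ (∑-distrib-+ f h) (∑-const m c))

∑-↑ : ∀ a b (f : Fin (a + b) → ℕ) → ∑[ i < a + b ] f i ≡ ∑[ i < a ] f (i ↑ˡ b) + ∑[ j < b ] f (a ↑ʳ j)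
∑-↑ zero    b f = refl
∑-↑ (suc a) b f = trans (cong (f 0F +_) (∑-↑ a b (f ∘ sucF))) (sym (+-assoc (f 0F) _ _))

upperSum : ∀ {n} → (Fin n → Fin n → ℕ) → ℕ
upperSum {n} f = ∑[ i < n ] ∑[ j < n ] (if toℕ i <ᵇ toℕ j then f i j else 0)

pairSum≡upperSum : ∀ G f → pairSum G f ≡ upperSum f
pairSum≡upperSum G f = trans (sum-map-allFin (λ i → sum (map (h i) (allFin _)))) (sum-cong-≗ (sum-map-allFin ∘ h))
  where
  h : Fin (order G) → Fin (order G) → ℕ
  h i j = if toℕ i <ᵇ toℕ j then f i j else 0

twice-upperSum : ∀ {n} (f : Fin n → Fin n → ℕ) → (∀ i j → f i j ≡ f j i) → (∀ i → f i i ≡ 0) →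
  2 * upperSum f ≡ ∑[ i < n ] ∑[ j < n ] f i j
twice-upperSum {n} f f-sym f-diag = begin
  2 * upperSum f                                    ≡⟨ cong (upperSum f +_) (+-identityʳ _) ⟩
  upperSum f + upperSum f                           ≡⟨ cong (upperSum f +_) (∑-comm h) ⟩
  upperSum f + ∑[ i < n ] ∑[ j < n ] h j i          ≡⟨ ∑-distrib-+ (λ i → ∑[ j < n ] h i j) _ ⟨
  ∑[ i < n ] (∑[ j < n ] h i j + ∑[ j < n ] h j i)  ≡⟨ sum-cong-≗ (λ i → ∑-distrib-+ (h i) (λ j → h j i)) ⟨
  ∑[ i < n ] ∑[ j < n ] (h i j + h j i)             ≡⟨ sum-cong-≗ (sum-cong-≗ ∘ upper+lower) ⟩
  ∑[ i < n ] ∑[ j < n ] f i j                       ∎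
  where
  open ≡-Reasoning
  h : Fin n → Fin n → ℕ
  h i j = if toℕ i <ᵇ toℕ j then f i j else 0
  upper+lower : ∀ i j → h i j + h j i ≡ f i j
  upper+lower i j with toℕ i <ᵇ toℕ j | <ᵇ-reflects-< (toℕ i) (toℕ j)
                    | toℕ j <ᵇ toℕ i | <ᵇ-reflects-< (toℕ j) (toℕ i)
  ... | true  | ofʸ i<j | true  | ofʸ j<i = contradiction j<i (<⇒≯ i<j)
  ... | true  | _       | false | _       = +-identityʳ (f i j)
  ... | false | _       | true  | _       = f-sym j i
  ... | false | ofⁿ i≮j | false | ofⁿ j≮i
    with toℕ-injective {i = i} {j = j} (≤-antisym (≮⇒≥ j≮i) (≮⇒≥ i≮j))
  ...   | refl = sym (f-diag i)

gap : ∀ {m} → Fin m → Fin m → ℕ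
gap i j = ∣ toℕ i - toℕ j ∣

Consecutive : ℕ → ℕ → Set
Consecutive a b = suc a ≡ b ⊎ suc b ≡ a

∣x-a∣-∣x-1+a∣ : ∀ x a → Consecutive ∣ x - a ∣ ∣ x - suc a ∣
∣x-a∣-∣x-1+a∣ zero    a       = inj₁ refl
∣x-a∣-∣x-1+a∣ (suc x) zero    = inj₂ (cong suc (∣-∣-identityʳ x))
∣x-a∣-∣x-1+a∣ (suc x) (suc a) = ∣x-a∣-∣x-1+a∣ x a

∣-∣-consecutive : ∀ x {a b} → Consecutive a b → Consecutive ∣ x - a ∣ ∣ x - b ∣
∣-∣-consecutive x {a}     (inj₁ refl) = ∣x-a∣-∣x-1+a∣ x a
∣-∣-consecutive x {_} {b} (inj₂ refl) = swap (∣x-a∣-∣x-1+a∣ x b)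

∣1+x-x∣≡1 : ∀ x → ∣ suc x - x ∣ ≡ 1
∣1+x-x∣≡1 zero    = refl
∣1+x-x∣≡1 (suc x) = ∣1+x-x∣≡1 x

towards : ∀ {m} x y {e} → x < m → y < m → ∣ x - y ∣ ≡ suc e →
  ∃[ z ] z < m × Consecutive z y × ∣ x - z ∣ ≡ e
towards zero    (suc y) _   y<m refl = y , <⇒≤ y<m , inj₁ refl , refl
towards (suc x) zero    x<m _   refl = 1 , ≤-trans (s≤s (s≤s z≤n)) x<m , inj₂ refl , ∣-∣-identityʳ x
towards (suc x) (suc y) (s≤s x<m) (s≤s y<m) eq with towards x y x<m y<m eq
... | z , z<m , c , e = suc z , s≤s z<m , map⊎ (cong suc) (cong suc) c , e

neighbour : ∀ {m} x → x < m → 2 ≤ m → ∃[ z ] z < m × Consecutive z x × ∣ x - z ∣ ≡ 1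
neighbour zero    _   2≤m = 1 , 2≤m , inj₂ refl , refl
neighbour (suc x) x<m _   = x , <-trans (n<1+n x) x<m , inj₁ refl , ∣1+x-x∣≡1 x

∃<⇒∃Fin : ∀ {m} {P : ℕ → Set} → ∃[ z ] z < m × P z → ∃[ z ] P (toℕ {m} z)
∃<⇒∃Fin {P = P} (z , z<m , pz) = fromℕ< z<m , subst P (sym (toℕ-fromℕ< z<m)) pz

towardsFin : ∀ {m} (x y : Fin m) {e} → gap x y ≡ suc e → ∃[ z ] Consecutive (toℕ z) (toℕ y) × gap x z ≡ e
towardsFin x y eq = ∃<⇒∃Fin (towards (toℕ x) (toℕ y) (toℕ<n x) (toℕ<n y) eq)

neighbourFin : ∀ {m} → 2 ≤ m → (x : Fin m) → ∃[ z ] Consecutive (toℕ z) (toℕ x) × gap x z ≡ 1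
neighbourFin 2≤m x = ∃<⇒∃Fin (neighbour (toℕ x) (toℕ<n x) 2≤m)

gapSum : ℕ → (ℕ → ℕ) → ℕ
gapSum m φ = ∑[ i < m ] ∑[ j < m ] φ (gap i j)

gapSum-suc : ∀ m φ → gapSum (suc m) φ ≡ φ 0 + 2 * ∑[ d < m ] φ (suc (toℕ d)) + gapSum m φ
gapSum-suc m φ = begin
  gapSum (suc m) φ
    ≡⟨ cong (φ 0 + S +_) (∑-distrib-+ {m} (φ ∘ suc ∘ toℕ) (λ i → ∑[ j < m ] φ (gap i j))) ⟩
  (φ 0 + S) + (S + gapSum m φ)
    ≡⟨ regroup (φ 0) S (gapSum m φ) ⟩
  φ 0 + 2 * S + gapSum m φ
    ∎
  where
  open ≡-Reasoning
  S = ∑[ d < m ] φ (suc (toℕ d))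
  regroup : ∀ a s g → (a + s) + (s + g) ≡ a + 2 * s + g
  regroup = solve-∀

-- Gap profiles

-- A profile lists the values at the gaps 0, 1, 2, 3 and a common value for all gaps ≥ 4.
Profile : Set
Profile = Vector ℕ 5

saturate : ℕ → Fin 5
saturate 0 = 0F
saturate 1 = 1F
saturate 2 = 2F
saturate 3 = 3F
saturate _ = 4F

_at_ : Profile → ℕ → ℕ
P at d = P (saturate d)

suc-C-2 : ∀ q → q + q C 2 ≡ suc q C 2
suc-C-2 q = trans (cong (_+ q C 2) (sym (nC1≡n q))) (nCk+nC[k+1]≡[n+1]C[k+1] q 1)

-- Among 3 + q points of a path, 2 (3 + q − d) ordered pairs have gap d ≥ 1,
-- and 2 (q C 2) have gap ≥ 4.
gapPolynomial : ℕ → Profile → ℕ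
gapPolynomial q P = (3 + q) * P 0F + 2 * (2 + q) * P 1F + 2 * (1 + q) * P 2F + 2 * q * P 3F + 2 * (q C 2) * P 4F

gapSum-profile : ∀ P q → gapSum (3 + q) (P at_) ≡ gapPolynomial q P
gapSum-profile P zero = three-points (P 0F) (P 1F) (P 2F) (P 3F) (P 4F)
  where
  three-points : ∀ a b c d e → (a + (b + (c + 0))) + ((b + (a + (b + 0))) + ((c + (b + (a + 0))) + 0)) ≡
                               3 * a + 2 * 2 * b + 2 * 1 * c + 2 * 0 * d + 2 * 0 * e
  three-points = solve-∀
gapSum-profile P (suc q) = begin
  gapSum (4 + q) (P at_)
    ≡⟨ gapSum-suc (3 + q) (P at_) ⟩
  P 0F + 2 * (P 1F + (P 2F + (P 3F + ∑[ d < q ] P 4F))) + gapSum (3 + q) (P at_)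
    ≡⟨ cong₂ (λ s g → P 0F + 2 * (P 1F + (P 2F + (P 3F + s))) + g) (∑-const q (P 4F)) (gapSum-profile P q) ⟩
  P 0F + 2 * (P 1F + (P 2F + (P 3F + q * P 4F))) + gapPolynomial q P
    ≡⟨ add-point q (q C 2) (P 0F) (P 1F) (P 2F) (P 3F) (P 4F) ⟩
  (4 + q) * P 0F + 2 * (3 + q) * P 1F + 2 * (2 + q) * P 2F + 2 * suc q * P 3F + 2 * (q + q C 2) * P 4F
    ≡⟨ cong (λ c → (4 + q) * P 0F + 2 * (3 + q) * P 1F + 2 * (2 + q) * P 2F + 2 * suc q * P 3F + 2 * c * P 4F)
            (suc-C-2 q) ⟩
  gapPolynomial (suc q) P
    ∎
  where
  open ≡-Reasoning
  add-point : ∀ q c a b d e f →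
    a + 2 * (b + (d + (e + q * f))) + ((3 + q) * a + 2 * (2 + q) * b + 2 * (1 + q) * d + 2 * q * e + 2 * c * f)
    ≡ (4 + q) * a + 2 * (3 + q) * b + 2 * (2 + q) * d + 2 * suc q * e + 2 * (q + c) * f
  add-point = solve-∀

-- A statement about the values at the consecutive gaps d + 1 and d is the same for all d ≥ 4,
-- so it can be decided.
Stepwise : (Fin 5 → Fin 5 → Set) → Set
Stepwise R = ∀ d → R (saturate (suc d)) (saturate d)

stepwise : ∀ {R} → (∀ (i : Fin 5) → R (saturate (suc (toℕ i))) (saturate (toℕ i))) → Stepwise R
stepwise h 0 = h 0F
stepwise h 1 = h 1F
stepwise h 2 = h 2F
stepwise h 3 = h 3F
stepwise h (suc (suc (suc (suc _)))) = h 4F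

decideStepwise : ∀ {R} (R? : ∀ a b → Dec (R a b)) →
  True (all? (λ (i : Fin 5) → R? (saturate (suc (toℕ i))) (saturate (toℕ i)))) → Stepwise R
decideStepwise {R} R? ok = stepwise {R} (toWitness ok)

decideEverywhere : ∀ {R : ℕ → Set} (R? : ∀ x → Dec (R x)) (P : Profile) →
  True (all? (R? ∘ P)) → ∀ d → R (P at d)
decideEverywhere R? P ok d = toWitness ok (saturate d)

StepBound : Profile → Profile → Set
StepBound P Q = Stepwise (λ a b → P a ≤ suc (Q b) × P b ≤ suc (Q a))

stepBound? : (P Q : Profile) (a b : Fin 5) → Dec (P a ≤ suc (Q b) × P b ≤ suc (Q a))
stepBound? P Q a b = (P a ≤? suc (Q b)) ×-dec (P b ≤? suc (Q a))

stepBound-≤ : ∀ {P Q} → StepBound P Q → ∀ {d e} → Consecutive d e → P at e ≤ suc (Q at d)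
stepBound-≤ h {d}     (inj₁ refl) = proj₁ (h d)
stepBound-≤ h {_} {e} (inj₂ refl) = proj₂ (h e)

-- For concrete profiles `ok` reduces to ⊤, so it is filled in by evaluation.
gapStep-≤ : ∀ P Q {ok : True (all? (λ (i : Fin 5) → stepBound? P Q (saturate (suc (toℕ i))) (saturate (toℕ i))))} →
  ∀ {d e} → Consecutive d e → P at e ≤ suc (Q at d)
gapStep-≤ P Q {ok} = stepBound-≤ {P} {Q} (decideStepwise (stepBound? P Q) ok)

-- Distances in the Mycielskian of a path

-- d(v i, v j), d(v i, u j) and d(u i, u j) as functions of the gap |i − j|.
vvGap vuGap uuGap : Profile
vvGap = 0 ∷ 1 ∷ 2 ∷ 3 ∷ 4 ∷ []
vuGap = 2 ∷ 1 ∷ 2 ∷ 3 ∷ 3 ∷ []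
uuGap = 0 ∷ 2 ∷ 2 ∷ 2 ∷ 2 ∷ []

vv-descent : ∀ e → vvGap at suc e ≡ suc (vvGap at e) ⊎ vvGap at suc e ≡ suc (vuGap at e)
vv-descent = decideStepwise (λ a b → (vvGap a ≟ suc (vvGap b)) ⊎-dec (vvGap a ≟ suc (vuGap b))) _

vu-descent : ∀ e → vuGap at suc e ≡ suc (vvGap at e) ⊎ vuGap at suc e ≡ 3
vu-descent = decideStepwise (λ a b → (vuGap a ≟ suc (vvGap b)) ⊎-dec (vuGap a ≟ 3)) _

uv-descent : ∀ e → vuGap at suc e ≡ suc (uuGap at e) ⊎ vuGap at suc e ≡ suc (vuGap at e)
uv-descent = decideStepwise (λ a b → (vuGap a ≟ suc (uuGap b)) ⊎-dec (vuGap a ≟ suc (vuGap b))) _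

uu-descent : ∀ e → uuGap at suc e ≡ 2
uu-descent = decideStepwise (λ a _ → uuGap a ≟ 2) _

μPDist : ∀ {m} → MV m → MV m → ℕ
μPDist (vv i) (vv j) = vvGap at gap i j
μPDist (vv i) (uu j) = vuGap at gap i j
μPDist (uu i) (vv j) = vuGap at gap i j
μPDist (uu i) (uu j) = uuGap at gap i j
μPDist (vv _) ww     = 2
μPDist (uu _) ww     = 1
μPDist ww     (vv _) = 2
μPDist ww     (uu _) = 1
μPDist ww     ww     = 0

μPDist-sym : ∀ {m} (a b : MV m) → μPDist a b ≡ μPDist b a
μPDist-sym (vv i) (vv j) = cong (vvGap at_) (∣-∣-comm (toℕ i) (toℕ j))
μPDist-sym (vv i) (uu j) = cong (vuGap at_) (∣-∣-comm (toℕ i) (toℕ j))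
μPDist-sym (uu i) (vv j) = cong (vuGap at_) (∣-∣-comm (toℕ i) (toℕ j))
μPDist-sym (uu i) (uu j) = cong (uuGap at_) (∣-∣-comm (toℕ i) (toℕ j))
μPDist-sym (vv _) ww     = refl
μPDist-sym (uu _) ww     = refl
μPDist-sym ww     (vv _) = refl
μPDist-sym ww     (uu _) = refl
μPDist-sym ww     ww     = refl

μPDist≤4 : ∀ {m} (a b : MV m) → μPDist a b ≤ 4
μPDist≤4 (vv i) (vv j) = decideEverywhere (_≤? 4) vvGap _ (gap i j)
μPDist≤4 (vv i) (uu j) = decideEverywhere (_≤? 4) vuGap _ (gap i j)
μPDist≤4 (uu i) (vv j) = decideEverywhere (_≤? 4) vuGap _ (gap i j)
μPDist≤4 (uu i) (uu j) = decideEverywhere (_≤? 4) uuGap _ (gap i j)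
μPDist≤4 (vv _) ww     = s≤s (s≤s z≤n)
μPDist≤4 (uu _) ww     = s≤s z≤n
μPDist≤4 ww     (vv _) = s≤s (s≤s z≤n)
μPDist≤4 ww     (uu _) = s≤s z≤n
μPDist≤4 ww     ww     = z≤n

module _ {n : ℕ} where
  pathAdj⇒consecutive : ∀ {i j : Fin (suc n)} → T (adj (path n) i j) → Consecutive (toℕ i) (toℕ j)
  pathAdj⇒consecutive = map⊎ (≡ᵇ⇒≡ _ _) (≡ᵇ⇒≡ _ _) ∘ to T-∨

  consecutive⇒pathAdj : ∀ {i j : Fin (suc n)} → Consecutive (toℕ i) (toℕ j) → T (adj (path n) i j)
  consecutive⇒pathAdj = from T-∨ ∘ map⊎ (≡⇒≡ᵇ _ _) (≡⇒≡ᵇ _ _)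

  gap-consecutive : ∀ (x : Fin (suc n)) {i j} → T (adj (path n) i j) → Consecutive (gap x i) (gap x j)
  gap-consecutive x e = ∣-∣-consecutive (toℕ x) (pathAdj⇒consecutive e)

  μPDist-refl : ∀ (a : MV (suc n)) → μPDist a a ≡ 0
  μPDist-refl (vv x) = cong (vvGap at_) (∣n-n∣≡0 (toℕ x))
  μPDist-refl (uu x) = cong (uuGap at_) (∣n-n∣≡0 (toℕ x))
  μPDist-refl ww     = refl

  μPDist≡0⇒≡ : ∀ {a b : MV (suc n)} → μPDist a b ≡ 0 → a ≡ b
  μPDist≡0⇒≡ {vv x} {vv y} h with gap x y in g
  ... | zero  = cong vv (toℕ-injective (∣m-n∣≡0⇒m≡n g))
  ... | suc e = contradiction h (decideStepwise (λ a _ → ¬? (vvGap a ≟ 0)) _ e)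
  μPDist≡0⇒≡ {uu x} {uu y} h with gap x y in g
  ... | zero  = cong uu (toℕ-injective (∣m-n∣≡0⇒m≡n g))
  ... | suc e = contradiction h (decideStepwise (λ a _ → ¬? (uuGap a ≟ 0)) _ e)
  μPDist≡0⇒≡ {vv x} {uu y} h = contradiction h (decideEverywhere (λ d → ¬? (d ≟ 0)) vuGap _ (gap x y))
  μPDist≡0⇒≡ {uu x} {vv y} h = contradiction h (decideEverywhere (λ d → ¬? (d ≟ 0)) vuGap _ (gap x y))
  μPDist≡0⇒≡ {ww}   {ww}   _ = refl

  μPDist-edge : ∀ a {w v} → T (myAdj (suc n) (adj (path n)) w v) → μPDist a v ≤ suc (μPDist a w)
  μPDist-edge (vv x) {vv i} {vv j} e = gapStep-≤ vvGap vvGap (gap-consecutive x e)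
  μPDist-edge (vv x) {vv i} {uu j} e = gapStep-≤ vuGap vvGap (swap (gap-consecutive x e))
  μPDist-edge (vv x) {uu i} {vv j} e = gapStep-≤ vvGap vuGap (gap-consecutive x e)
  μPDist-edge (vv x) {uu i} {ww}   _ = s≤s (decideEverywhere (1 ≤?_) vuGap _ (gap x i))
  μPDist-edge (vv x) {ww}   {uu j} _ = decideEverywhere (_≤? 3) vuGap _ (gap x j)
  μPDist-edge (uu x) {vv i} {vv j} e = gapStep-≤ vuGap vuGap (gap-consecutive x e)
  μPDist-edge (uu x) {vv i} {uu j} e = gapStep-≤ uuGap vuGap (swap (gap-consecutive x e))
  μPDist-edge (uu x) {uu i} {vv j} e = gapStep-≤ vuGap uuGap (gap-consecutive x e)
  μPDist-edge (uu x) {uu i} {ww}   _ = s≤s z≤n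
  μPDist-edge (uu x) {ww}   {uu j} _ = decideEverywhere (_≤? 2) uuGap _ (gap x j)
  μPDist-edge ww     {vv i} {vv j} _ = s≤s (s≤s z≤n)
  μPDist-edge ww     {vv i} {uu j} _ = s≤s z≤n
  μPDist-edge ww     {uu i} {vv j} _ = ≤-refl
  μPDist-edge ww     {uu i} {ww}   _ = z≤n
  μPDist-edge ww     {ww}   {uu j} _ = ≤-refl
  μPDist-edge _      {vv _} {ww}   ()
  μPDist-edge _      {uu _} {uu _} ()
  μPDist-edge _      {ww}   {vv _} ()
  μPDist-edge _      {ww}   {ww}   ()

  -- When v lies over a path index at positive gap from a, a predecessor lies over the
  -- neighbouring index one step closer (towardsFin); the descent facts pick its layer.
  μPDist-predecessor : 1 ≤ n → ∀ a {v d} → μPDist a v ≡ suc d →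
    ∃[ w ] T (myAdj (suc n) (adj (path n)) w v) × μPDist a w ≡ d
  μPDist-predecessor _ (vv x) {vv y} h with gap x y in g
  μPDist-predecessor _ (vv x) {vv y} () | zero
  ... | suc e with towardsFin x y g | vv-descent e
  ...   | z , c , gz | inj₁ p = vv z , consecutive⇒pathAdj c
                              , trans (cong (vvGap at_) gz) (suc-injective (trans (sym p) h))
  ...   | z , c , gz | inj₂ p = uu z , consecutive⇒pathAdj c
                              , trans (cong (vuGap at_) gz) (suc-injective (trans (sym p) h))
  μPDist-predecessor 1≤n (vv x) {uu y} h with gap x y in g
  ... | zero with neighbourFin (s≤s 1≤n) x
  ...   | z , c , gz = vv z , consecutive⇒pathAdj (subst (λ t → Consecutive t (toℕ z)) (∣m-n∣≡0⇒m≡n g) (swap c))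
                     , trans (cong (vvGap at_) gz) (suc-injective h)
  μPDist-predecessor _ (vv x) {uu y} h | suc e with towardsFin x y g | vu-descent e
  ...   | z , c , gz | inj₁ p = vv z , consecutive⇒pathAdj (swap c)
                              , trans (cong (vvGap at_) gz) (suc-injective (trans (sym p) h))
  ...   | _ , _ , _  | inj₂ p = ww , _ , suc-injective (trans (sym p) h)
  μPDist-predecessor 1≤n (vv x) {ww} h with neighbourFin (s≤s 1≤n) x
  ... | z , _ , gz = uu z , _ , trans (cong (vuGap at_) gz) (suc-injective h)
  μPDist-predecessor 1≤n (uu x) {vv y} h with gap x y in g
  ... | zero with neighbourFin (s≤s 1≤n) x
  ...   | z , c , gz = vv z , consecutive⇒pathAdj (subst (Consecutive (toℕ z)) (∣m-n∣≡0⇒m≡n g) c)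
                     , trans (cong (vuGap at_) gz) (suc-injective h)
  μPDist-predecessor _ (uu x) {vv y} h | suc e with towardsFin x y g | uv-descent e
  ...   | z , c , gz | inj₁ p = uu z , consecutive⇒pathAdj c
                              , trans (cong (uuGap at_) gz) (suc-injective (trans (sym p) h))
  ...   | z , c , gz | inj₂ p = vv z , consecutive⇒pathAdj c
                              , trans (cong (vuGap at_) gz) (suc-injective (trans (sym p) h))
  μPDist-predecessor _ (uu x) {uu y} h with gap x y
  μPDist-predecessor _ (uu x) {uu y} () | zero
  ... | suc e = ww , _ , suc-injective (trans (sym (uu-descent e)) h)
  μPDist-predecessor _ (uu x) {ww} refl = uu x , _ , cong (uuGap at_) (∣n-n∣≡0 (toℕ x))
  μPDist-predecessor 1≤n ww {vv y} refl with neighbourFin (s≤s 1≤n) y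
  ... | z , c , _ = uu z , consecutive⇒pathAdj c , refl
  μPDist-predecessor _ ww {uu y} refl = ww , _ , refl
  μPDist-predecessor _ ww {ww} ()

  μPDist-isGraphDistance : 1 ≤ n → IsGraphDistance (myAdj (suc n) (adj (path n))) μPDist
  μPDist-isGraphDistance 1≤n = record
    { δ≡0⇒≡         = μPDist≡0⇒≡
    ; δ-refl        = μPDist-refl
    ; δ-edge        = μPDist-edge
    ; δ-predecessor = μPDist-predecessor 1≤n
    }

embed : ∀ {m} → MV m → Fin (m + (m + 1))
embed {m} (vv i) = i ↑ˡ (m + 1)
embed {m} (uu i) = m ↑ʳ (i ↑ˡ 1)
embed {m} ww     = m ↑ʳ (m ↑ʳ 0F)

classify-embed : ∀ m a → classify m (embed a) ≡ a
classify-embed m (vv i) rewrite splitAt-↑ˡ m i (m + 1) = refl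
classify-embed m (uu i) rewrite splitAt-↑ʳ m (m + 1) (i ↑ˡ 1) | splitAt-↑ˡ m i 1 = refl
classify-embed m ww     rewrite splitAt-↑ʳ m (m + 1) (m ↑ʳ 0F) | splitAt-↑ʳ m 1 0F = refl

embed-classify : ∀ m x → embed (classify m x) ≡ x
embed-classify m x with splitAt m x | join-splitAt m (m + 1) x
... | inj₁ i | x≡ = x≡
... | inj₂ y | x≡ with splitAt m y | join-splitAt m 1 y
...   | inj₁ i  | y≡ = trans (cong (m ↑ʳ_) y≡) x≡
...   | inj₂ 0F | y≡ = trans (cong (m ↑ʳ_) y≡) x≡

module _ (n : ℕ) where
  μP : Graph
  μP = mycielskian (path n)

  δμP : Fin (order μP) → Fin (order μP) → ℕ
  δμP x y = μPDist (classify (suc n) x) (classify (suc n) y)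

  module _ (1≤n : 1 ≤ n) where
    δμP-isGraphDistance : IsGraphDistance (adj μP) δμP
    δμP-isGraphDistance = IsGraphDistance-pullback (classify (suc n)) embed
                            (classify-embed (suc n)) (embed-classify (suc n)) (μPDist-isGraphDistance 1≤n)

    distIs-μP : ∀ k x y → distIs μP (suc k) x y ≡ (δμP x y ≡ᵇ suc k)
    distIs-μP = distIs≡δ≡ᵇ δμP-isGraphDistance

    dist-μP : ∀ x y → dist μP x y ≡ δμP x y
    dist-μP x y = dist≡δ δμP-isGraphDistance (+-mono-≤ (s≤s 1≤n) (+-monoˡ-≤ 1 (s≤s 1≤n))) x y
                    (μPDist≤4 (classify (suc n) x) (classify (suc n) y))

-- Counting pairs

∑ᴹ : ∀ {m} → (MV m → ℕ) → ℕ
∑ᴹ {m} K = ∑[ i < m ] K (vv i) + ∑[ i < m ] K (uu i) + K ww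

∑-classify : ∀ m (K : MV m → ℕ) → ∑[ x < m + (m + 1) ] K (classify m x) ≡ ∑ᴹ K
∑-classify m K = begin
  ∑[ x < m + (m + 1) ] K (classify m x)
    ≡⟨ ∑-↑ m (m + 1) _ ⟩
  ∑[ i < m ] K (classify m (embed (vv i))) + ∑[ y < m + 1 ] K (classify m (m ↑ʳ y))
    ≡⟨ cong (∑[ i < m ] K (classify m (embed (vv i))) +_) (∑-↑ m 1 _) ⟩
  ∑[ i < m ] K (classify m (embed (vv i))) + (∑[ i < m ] K (classify m (embed (uu i))) + (K (classify m (embed {m} ww)) + 0))
    ≡⟨ cong₂ _+_ (sum-cong-≗ (cong K ∘ classify-embed m ∘ vv))
                 (cong₂ _+_ (sum-cong-≗ (cong K ∘ classify-embed m ∘ uu))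
                            (cong (_+ 0) (cong K (classify-embed m ww)))) ⟩
  ∑[ i < m ] K (vv i) + (∑[ i < m ] K (uu i) + (K ww + 0))
    ≡⟨ regroup (∑[ i < m ] K (vv i)) (∑[ i < m ] K (uu i)) (K ww) ⟩
  ∑ᴹ K
    ∎
  where
  open ≡-Reasoning
  regroup : ∀ a b c → a + (b + (c + 0)) ≡ a + b + c
  regroup = solve-∀

-- Ordered pairs at distance d in μP (2 + p); the p C 2 pairs {v i, v j} with |i − j| ≥ 4
-- are the only ones at distance 4.
orderedPairsAt : ℕ → ℕ → ℕ
orderedPairsAt p 0 = 7 + 2 * p
orderedPairsAt p 1 = 18 + 8 * p
orderedPairsAt p 2 = 24 + 16 * p + 2 * (p C 2)
orderedPairsAt p 3 = 6 * p + 4 * (p C 2)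
orderedPairsAt p 4 = 2 * (p C 2)
orderedPairsAt p _ = 0

distanceDistribution-μP : ∀ p (g : ℕ → ℕ) → let N = order (μP (2 + p)) in
  ∑[ x < N ] ∑[ y < N ] g (δμP (2 + p) x y) ≡ ∑[ d < 5 ] (g (toℕ d) * orderedPairsAt p (toℕ d))
distanceDistribution-μP p g = begin
    ∑[ x < N ] ∑[ y < N ] g (μPDist (classify m x) (classify m y))
  ≡⟨ sum-cong-≗ (λ x → ∑-classify m (g ∘ μPDist (classify m x))) ⟩
    ∑[ x < N ] ∑ᴹ (g ∘ μPDist (classify m x))
  ≡⟨ ∑-classify m (λ a → ∑ᴹ (g ∘ μPDist a)) ⟩
    ∑ᴹ {m} (λ a → ∑ᴹ (g ∘ μPDist a))
  ≡⟨ cong₂ _+_ (cong₂ _+_ (row vvGap vuGap 2) (row vuGap uuGap 1))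
               (cong₂ (λ s t → s + t + g 0) (∑-const m (g 2)) (∑-const m (g 1))) ⟩
    (Γ (g ∘ vvGap) + Γ (g ∘ vuGap) + m * g 2) + (Γ (g ∘ vuGap) + Γ (g ∘ uuGap) + m * g 1) + (m * g 2 + m * g 1 + g 0)
  ≡⟨ collect p (p C 2) (g 0) (g 1) (g 2) (g 3) (g 4) ⟩
    ∑[ d < 5 ] (g (toℕ d) * orderedPairsAt p (toℕ d))
  ∎
  where
  open ≡-Reasoning
  m = 3 + p
  N = m + (m + 1)
  Γ = gapPolynomial p
  row : ∀ P Q k → ∑[ i < m ] (∑[ j < m ] g (P at gap i j) + ∑[ j < m ] g (Q at gap i j) + g k)
                  ≡ Γ (g ∘ P) + Γ (g ∘ Q) + m * g k
  row P Q k = trans (∑-+-const m (λ i → ∑[ j < m ] g (P at gap i j)) (λ i → ∑[ j < m ] g (Q at gap i j)) (g k))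
                    (cong₂ (λ a b → a + b + m * g k) (gapSum-profile (g ∘ P) p) (gapSum-profile (g ∘ Q) p))
  collect : ∀ p c g₀ g₁ g₂ g₃ g₄ →
      ((3 + p) * g₀ + 2 * (2 + p) * g₁ + 2 * (1 + p) * g₂ + 2 * p * g₃ + 2 * c * g₄
       + ((3 + p) * g₂ + 2 * (2 + p) * g₁ + 2 * (1 + p) * g₂ + 2 * p * g₃ + 2 * c * g₃) + (3 + p) * g₂)
    + ((3 + p) * g₂ + 2 * (2 + p) * g₁ + 2 * (1 + p) * g₂ + 2 * p * g₃ + 2 * c * g₃
       + ((3 + p) * g₀ + 2 * (2 + p) * g₂ + 2 * (1 + p) * g₂ + 2 * p * g₂ + 2 * c * g₂) + (3 + p) * g₁)
    + ((3 + p) * g₂ + (3 + p) * g₁ + g₀)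
    ≡ g₀ * (7 + 2 * p) + (g₁ * (18 + 8 * p) + (g₂ * (24 + 16 * p + 2 * c)
      + (g₃ * (6 * p + 4 * c) + (g₄ * (2 * c) + 0))))
  collect = solve-∀

twice-pairSum-μP : ∀ p f (g : ℕ → ℕ) → g 0 ≡ 0 → (∀ x y → f x y ≡ g (δμP (2 + p) x y)) →
  2 * pairSum (μP (2 + p)) f ≡ ∑[ d < 5 ] (g (toℕ d) * orderedPairsAt p (toℕ d))
twice-pairSum-μP p f g g0≡0 f≡ = begin
  2 * pairSum (μP n) f                                ≡⟨ cong (2 *_) (pairSum≡upperSum (μP n) f) ⟩
  2 * upperSum f                                      ≡⟨ twice-upperSum f f-sym f-diag ⟩
  ∑[ x < N ] ∑[ y < N ] f x y                         ≡⟨ sum-cong-≗ (sum-cong-≗ ∘ f≡) ⟩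
  ∑[ x < N ] ∑[ y < N ] g (δμP n x y)                 ≡⟨ distanceDistribution-μP p g ⟩
  ∑[ d < 5 ] (g (toℕ d) * orderedPairsAt p (toℕ d))   ∎
  where
  open ≡-Reasoning
  n = 2 + p
  N = order (μP n)
  f-sym : ∀ x y → f x y ≡ f y x
  f-sym x y = trans (f≡ x y) (trans (cong g (μPDist-sym (classify (suc n) x) _)) (sym (f≡ y x)))
  f-diag : ∀ x → f x x ≡ 0
  f-diag x = trans (f≡ x x) (trans (cong g (μPDist-refl (classify (suc n) x))) g0≡0)

indicator : ℕ → ℕ → ℕ
indicator k d = if d ≡ᵇ k then 1 else 0

twice-dcount-μP : ∀ p k → 2 * dcount (μP (2 + p)) (suc k) ≡ orderedPairsAt p (suc k)
twice-dcount-μP p k =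
  trans (twice-pairSum-μP p _ (indicator (suc k)) refl
           (λ x y → cong (if_then 1 else 0) (distIs-μP (2 + p) (s≤s z≤n) k x y)))
        (select k)
  where
  select : ∀ k → ∑[ d < 5 ] (indicator (suc k) (toℕ d) * orderedPairsAt p (toℕ d)) ≡ orderedPairsAt p (suc k)
  select 0 = trans (+-identityʳ _) (+-identityʳ _)
  select 1 = trans (+-identityʳ _) (+-identityʳ _)
  select 2 = trans (+-identityʳ _) (+-identityʳ _)
  select 3 = trans (+-identityʳ _) (+-identityʳ _)
  select (suc (suc (suc (suc _)))) = refl

twice-wiener-μP : ∀ p → 2 * wiener (μP (2 + p)) ≡ ∑[ d < 5 ] (toℕ d * orderedPairsAt p (toℕ d))
twice-wiener-μP p = twice-pairSum-μP p _ id refl (dist-μP (2 + p) (s≤s z≤n))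

twice-C-2 : ∀ p → 2 * (p C 2) + p ≡ p * p
twice-C-2 zero    = refl
twice-C-2 (suc p) = begin
  2 * (suc p C 2) + suc p          ≡⟨ cong (λ c → 2 * c + suc p) (suc-C-2 p) ⟨
  2 * (p + p C 2) + suc p          ≡⟨ expand p (p C 2) ⟩
  (2 * (p C 2) + p) + (1 + 2 * p)  ≡⟨ cong (_+ (1 + 2 * p)) (twice-C-2 p) ⟩
  p * p + (1 + 2 * p)              ≡⟨ square-suc p ⟩
  suc p * suc p                    ∎
  where
  open ≡-Reasoning
  expand : ∀ p c → 2 * (p + c) + suc p ≡ (2 * c + p) + (1 + 2 * p)
  expand = solve-∀
  square-suc : ∀ p → p * p + (1 + 2 * p) ≡ suc p * suc p
  square-suc = solve-∀

square-2+p : ∀ p → (2 + p) * (2 + p) ≡ 2 * (p C 2) + 5 * p + 4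
square-2+p p = begin
  (2 + p) * (2 + p)            ≡⟨ expand p ⟩
  p * p + 4 * p + 4            ≡⟨ cong (λ s → s + 4 * p + 4) (twice-C-2 p) ⟨
  2 * (p C 2) + p + 4 * p + 4  ≡⟨ collect p (p C 2) ⟩
  2 * (p C 2) + 5 * p + 4      ∎
  where
  open ≡-Reasoning
  expand : ∀ p → (2 + p) * (2 + p) ≡ p * p + 4 * p + 4
  expand = solve-∀
  collect : ∀ p c → 2 * c + p + 4 * p + 4 ≡ 2 * c + 5 * p + 4
  collect = solve-∀

hosoyaRHS2≡orderedPairsAt : ∀ p k → hosoyaRHS2 (2 + p) (suc k) ≡ orderedPairsAt p (suc k)
hosoyaRHS2≡orderedPairsAt p 0 = coefficient₁ p
  where
  coefficient₁ : ∀ p → 2 * (4 * (2 + p) + 1) ≡ 18 + 8 * p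
  coefficient₁ = solve-∀
hosoyaRHS2≡orderedPairsAt p 1 =
  m≡n+o⇒m∸n≡o {(2 + p) * (2 + p) + 11 * (2 + p)} {2}
    (trans (cong (_+ 11 * (2 + p)) (square-2+p p)) (coefficient₂ p (p C 2)))
  where
  coefficient₂ : ∀ p c → 2 * c + 5 * p + 4 + 11 * (2 + p) ≡ 2 + (24 + 16 * p + 2 * c)
  coefficient₂ = solve-∀
hosoyaRHS2≡orderedPairsAt p 2 =
  trans (cong (2 *_) (m≡n+o⇒m∸n≡o {(2 + p) * (2 + p)} {2 * (2 + p)} (trans (square-2+p p) (split p (p C 2)))))
        (coefficient₃ p (p C 2))
  where
  split : ∀ p c → 2 * c + 5 * p + 4 ≡ 2 * (2 + p) + (2 * c + 3 * p)
  split = solve-∀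
  coefficient₃ : ∀ p c → 2 * (2 * c + 3 * p) ≡ 6 * p + 4 * c
  coefficient₃ = solve-∀
hosoyaRHS2≡orderedPairsAt p 3 =
  m≡n+o⇒m∸n≡o {(2 + p) * (2 + p) + 6} {5 * (2 + p)} (trans (cong (_+ 6) (square-2+p p)) (coefficient₄ p (p C 2)))
  where
  coefficient₄ : ∀ p c → 2 * c + 5 * p + 4 + 6 ≡ 5 * (2 + p) + 2 * c
  coefficient₄ = solve-∀
hosoyaRHS2≡orderedPairsAt p (suc (suc (suc (suc _)))) = refl

wiener-μP : ∀ p → wiener (μP (2 + p)) ≡ 6 * (2 + p) * (2 + p) + 11 ∸ (2 + p)
wiener-μP p = *-cancelˡ-≡ _ _ 2 (begin
  2 * wiener (μP (2 + p))                         ≡⟨ twice-wiener-μP p ⟩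
  ∑[ d < 5 ] (toℕ d * orderedPairsAt p (toℕ d))   ≡⟨ weigh p c ⟩
  2 * (12 * c + 29 * p + 33)                      ≡⟨ cong (2 *_) (m≡n+o⇒m∸n≡o {n = 2 + p} closed) ⟨
  2 * (6 * (2 + p) * (2 + p) + 11 ∸ (2 + p))      ∎)
  where
  open ≡-Reasoning
  c = p C 2
  weigh : ∀ p c → 0 * (7 + 2 * p) + (1 * (18 + 8 * p) + (2 * (24 + 16 * p + 2 * c)
                  + (3 * (6 * p + 4 * c) + (4 * (2 * c) + 0)))) ≡ 2 * (12 * c + 29 * p + 33)
  weigh = solve-∀
  sixfold : ∀ p c → 6 * (2 * c + 5 * p + 4) + 11 ≡ (2 + p) + (12 * c + 29 * p + 33)
  sixfold = solve-∀
  closed : 6 * (2 + p) * (2 + p) + 11 ≡ (2 + p) + (12 * c + 29 * p + 33)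
  closed = trans (cong (_+ 11) (trans (*-assoc 6 (2 + p) (2 + p)) (cong (6 *_) (square-2+p p)))) (sixfold p c)

corollary3p10 : (n : ℕ) → 2 ≤ n →
    ((k : ℕ) → 1 ≤ k → 2 * dcount (mycielskian (path n)) k ≡ hosoyaRHS2 n k)
    × (wiener (mycielskian (path n)) ≡ 6 * n * n + 11 ∸ n)
corollary3p10 (suc (suc p)) _ = hosoya , wiener-μP p
  where
  hosoya : (k : ℕ) → 1 ≤ k → 2 * dcount (μP (2 + p)) k ≡ hosoyaRHS2 (2 + p) k
  hosoya (suc k) _ = trans (twice-dcount-μP p k) (sym (hosoyaRHS2≡orderedPairsAt p k))
corollary3p10 (suc zero) (s≤s ())
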